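{- Let $n\ge 2$ and let $A\in CP_n$ have positive trace. Then $\exp(A)=n+m(V_1)$.
   Context: For $n \ge 2$, $C_n$ is the set of all $n\times n$ $(0,1)$-matrices $A=(a_{ij})$ with $a_{i,i+1}=1$ for $1\le i\le n-1$, last row arbitrary in $\{0,1\}^n$, and all other entries $0$. These are the $(0,1)$ companion matrices. A nonnegative matrix $A$ is primitive if $A^m$ has all entries positive for some positive integer $m$. The smallest such $m$ is the exponent $\exp(A)$. $CP_n$ is the set of primitive matrices in $C_n$. For $A\in C_n$, let $V_1=\{i\in[1,n]: a_{ni}=0\}$ and $V_2=\{i\in[1,n]: a_{ni}>0\}$, where $[a,b]=\{i\in\mathbb Z: a\le i\le b\}$. For $U\subseteq[1,n]$, write $U$ as a disjoint union of maximal sets of consecutive integers $U_1\cup\dots\cup U_r$, and let $m(U)=\max_k |U_k|$, with $m(\emptyset)=0$. -}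

module Defs where

open import Data.Nat using (ℕ; zero; suc; _+_; _*_; _≤_; _<_; _⊔_)
open import Data.Fin using (Fin; toℕ)
open import Data.Bool using (Bool; true; false; if_then_else_)
open import Data.List using (List; []; _∷_; tabulate)
open import Data.Product using (Σ; _×_; ∃)
open import Relation.Binary.PropositionalEquality using (_≡_)
open import Relation.Nullary using (¬_)
open import Relation.Nullary.Decidable using (⌊_⌋)
import Data.Nat as ℕ

-- n×n matrices with natural-number (nonnegative) entries, 0-based indices
Mat : ℕ → Set
Mat n = Fin n → Fin n → ℕ

sumFin : ∀ {n} → (Fin n → ℕ) → ℕ
sumFin {zero}  f = 0
sumFin {suc n} f = f Fin.zero + sumFin (λ i → f (Fin.suc i))
  where import Data.Fin as Fin

_⊗_ : ∀ {n} → Mat n → Mat n → Mat n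
(A ⊗ B) i j = sumFin (λ k → A i k * B k j)

idMat : ∀ {n} → Mat n
idMat i j = if ⌊ toℕ i ℕ.≟ toℕ j ⌋ then 1 else 0

_^ᴹ_ : ∀ {n} → Mat n → ℕ → Mat n
A ^ᴹ zero  = idMat
A ^ᴹ suc k = A ⊗ (A ^ᴹ k)

trace : ∀ {n} → Mat n → ℕ
trace A = sumFin (λ i → A i i)

Positive : ∀ {n} → Mat n → Set
Positive A = ∀ i j → 0 < A i j

Primitive : ∀ {n} → Mat n → Set
Primitive A = Σ ℕ (λ m → (1 ≤ m) × Positive (A ^ᴹ m))

IsExponent : ∀ {n} → Mat n → ℕ → Set
IsExponent A e = (1 ≤ e) × Positive (A ^ᴹ e)
               × (∀ m → 1 ≤ m → m < e → ¬ Positive (A ^ᴹ m))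

-- (0,1) companion matrix with last row r (true = 1, false = 0).
-- 0-based: entry (i, i+1) is 1 for i < n-1, row n-1 is r, all else 0.
companion : ∀ {n} → (Fin n → Bool) → Mat n
companion {n} r i j =
  if ⌊ suc (toℕ i) ℕ.≟ n ⌋
  then (if r j then 1 else 0)
  else (if ⌊ toℕ j ℕ.≟ suc (toℕ i) ⌋ then 1 else 0)

-- Length of the longest block of consecutive list positions holding the
-- value false.  runAux cur best xs: cur = length of the current block.
runAux : ℕ → ℕ → List Bool → ℕ
runAux cur best []          = best ⊔ cur
runAux cur best (false ∷ xs) = runAux (suc cur) best xs
runAux cur best (true ∷ xs)  = runAux 0 (best ⊔ cur) xs

-- m(V₁) where V₁ = { i : a_{n i} = 0 } for the last row r:
-- the maximum size of a maximal set of consecutive indices in V₁ (0 if empty).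
mV₁ : ∀ {n} → (Fin n → Bool) → ℕ
mV₁ {n} r = runAux 0 0 (tabulate r)

module Submission where

-- Read a nonnegative matrix A as a digraph: (A^m)ᵢⱼ > 0 exactly when there is a
-- walk of length m from i to j.  For the companion matrix with last row r the
-- edges are the forward edges i → i+1 and the back edges (n-1) → k with r k = 1.
-- Positive trace means the back edge (n-1) → (n-1) is a loop; primitivity forces
-- r 0 = 1 (otherwise vertex 0 is only the end of the empty walk).
--
-- Let M = m(V₁) be the length of a longest block of zeros of r.
--   * Upper bound: to reach j from i in exactly n + M steps, walk forward to n-1,
--     wait on the loop, jump back to the start s of the zero block ending at j
--     (r s = 1 since r 0 = 1), and walk forward from s to j.
--   * Lower bound: the potential (index + length) of a walk ending at j either
--     equals j (the walk only moved forward) or is at least n + D, where D zeros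
--     of r precede j, because any back edge lands before that block.  Applied
--     to the walks 0 → 0 and 0 → (end of a longest zero block) this gives m ≥ n + M.

open import Defs
open import Data.Nat using (ℕ; _+_; _≤_; _<_)
open import Data.Fin using (Fin)
open import Data.Bool using (Bool)

open import Data.Nat using (zero; suc; _*_; _∸_; _⊔_; z≤n; s≤s; s≤s⁻¹; z<s; _≟_; _<?_)
open import Data.Nat.Properties
open import Data.Nat.Tactic.RingSolver using (solve-∀)
open import Data.Fin using (toℕ; fromℕ<) renaming (zero to fzero; suc to fsuc)
open import Data.Fin.Properties using (toℕ-injective; toℕ<n; toℕ-fromℕ<; fromℕ<-toℕ)
open import Data.Bool using (true; false; if_then_else_)
open import Data.List using (List; []; _∷_; tabulate)
open import Data.Product using (_×_; ∃; _,_; proj₁; proj₂)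
open import Data.Sum using (_⊎_; inj₁; inj₂)
open import Relation.Nullary using (¬_; Dec; yes; no; contradiction)
open import Relation.Nullary.Decidable using (⌊_⌋)
open import Relation.Binary.PropositionalEquality

sum-pos⁻¹ : ∀ {n} (g : Fin n → ℕ) → 0 < sumFin g → ∃ λ k → 0 < g k
sum-pos⁻¹ {suc n} g pos with g fzero in g0
... | suc _ = fzero , subst (0 <_) (sym g0) z<s
... | zero with sum-pos⁻¹ (λ k → g (fsuc k)) pos
...   | k , gk>0 = fsuc k , gk>0

sum-pos : ∀ {n} (g : Fin n → ℕ) k → 0 < g k → 0 < sumFin g
sum-pos g fzero    gk>0 = ≤-trans gk>0 (m≤m+n _ _)
sum-pos g (fsuc k) gk>0 = ≤-trans (sum-pos (λ i → g (fsuc i)) k gk>0) (m≤n+m _ _)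

*-pos⁻¹ : ∀ a b → 0 < a * b → 0 < a × 0 < b
*-pos⁻¹ (suc a) (suc b) _ = z<s , z<s
*-pos⁻¹ (suc a) zero pos = contradiction (*-zeroʳ a) (n>0⇒n≢0 pos)

*-pos : ∀ {a b} → 0 < a → 0 < b → 0 < a * b
*-pos {suc a} {suc b} _ _ = z<s

dec-pos : ∀ {P : Set} (d : Dec P) → P → 0 < (if ⌊ d ⌋ then 1 else 0)
dec-pos (yes _) _  = z<s
dec-pos (no ¬p) p = contradiction p ¬p

dec-pos⁻¹ : ∀ {P : Set} (d : Dec P) → 0 < (if ⌊ d ⌋ then 1 else 0) → P
dec-pos⁻¹ (yes p) _ = p

-- The shape of a companion-matrix entry: `b` on the last row, otherwise
-- the 0/1 value of a second decision.
select : ∀ {X Y : Set} → Dec X → Bool → Dec Y → ℕ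
select dX b dY = if ⌊ dX ⌋ then (if b then 1 else 0) else (if ⌊ dY ⌋ then 1 else 0)

select-pos⁻¹ : ∀ {X Y : Set} (dX : Dec X) b (dY : Dec Y) →
  0 < select dX b dY → (X × b ≡ true) ⊎ Y
select-pos⁻¹ (yes x) true dY _   = inj₁ (x , refl)
select-pos⁻¹ (no _)  b    dY pos = inj₂ (dec-pos⁻¹ dY pos)

select-then : ∀ {X Y : Set} (dX : Dec X) b (dY : Dec Y) → X → b ≡ true → 0 < select dX b dY
select-then (yes _) true dY _ _ = z<s
select-then (no ¬x) b    dY x _ = contradiction x ¬x

select-else : ∀ {X Y : Set} (dX : Dec X) b (dY : Dec Y) → ¬ X → Y → 0 < select dX b dY
select-else (yes x) b dY ¬x _ = contradiction x ¬x
select-else (no _)  b dY _  y = dec-pos dY y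

-- Walks in the digraph of a nonnegative matrix

-- `Walk A m i j`: the (i,j) entry of A^m is positive, i.e. the digraph of A
-- has a walk of length m from i to j.  (A record, so that A, m, i, j can be
-- inferred from the type.)
record Walk {n} (A : Mat n) (m : ℕ) (i j : Fin n) : Set where
  constructor walk
  field positive : 0 < (A ^ᴹ m) i j
open Walk public

module _ {n} {A : Mat n} where

  walk-refl : ∀ i → Walk A 0 i i
  walk-refl i = walk (dec-pos (toℕ i ≟ toℕ i) refl)

  walk-zero⁻¹ : ∀ {i j} → Walk A 0 i j → i ≡ j
  walk-zero⁻¹ {i} {j} (walk pos) = toℕ-injective (dec-pos⁻¹ (toℕ i ≟ toℕ j) pos)

  walk-cons : ∀ {m i k j} → 0 < A i k → Walk A m k j → Walk A (suc m) i j
  walk-cons {m} {i} {k} {j} edge (walk pos) =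
    walk (sum-pos (λ l → A i l * (A ^ᴹ m) l j) k (*-pos edge pos))

  walk-uncons : ∀ {m i j} → Walk A (suc m) i j → ∃ λ k → 0 < A i k × Walk A m k j
  walk-uncons {m} {i} {j} (walk pos) with sum-pos⁻¹ (λ l → A i l * (A ^ᴹ m) l j) pos
  ... | k , term>0 with *-pos⁻¹ (A i k) ((A ^ᴹ m) k j) term>0
  ...   | edge , rest = k , edge , walk rest

  walk-++ : ∀ {a b i k j} → Walk A a i k → Walk A b k j → Walk A (a + b) i j
  walk-++ {zero} w v = subst (λ x → Walk A _ x _) (sym (walk-zero⁻¹ w)) v
  walk-++ {suc a} w v with walk-uncons w
  ... | _ , edge , w′ = walk-cons edge (walk-++ w′ v)

-- Runs of `false` in a Boolean sequence

runBefore : (ℕ → Bool) → ℕ → ℕ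
runBefore f zero    = 0
runBefore f (suc j) with f j
... | true  = 0
... | false = suc (runBefore f j)

longestRun : (ℕ → Bool) → ℕ → ℕ
longestRun f zero    = 0
longestRun f (suc N) = longestRun f N ⊔ runBefore f (suc N)

FalseBlock : (ℕ → Bool) → ℕ → ℕ → Set
FalseBlock f j D = ∀ k → k ≤ j → j < k + D → f k ≡ false

module _ (f : ℕ → Bool) where

  runBefore≤longestRun : ∀ {j N} → j < N → runBefore f (suc j) ≤ longestRun f N
  runBefore≤longestRun {j} {suc N} j<1+N with m<1+n⇒m<n∨m≡n j<1+N
  ... | inj₁ j<N  = m≤n⇒m≤n⊔o _ (runBefore≤longestRun j<N)
  ... | inj₂ refl = m≤n⇒m≤o⊔n (longestRun f N) ≤-refl

  longestRun-attained : ∀ N → 0 < N → ∃ λ j → j < N × runBefore f (suc j) ≡ longestRun f N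
  longestRun-attained (suc zero) _ = 0 , z<s , refl
  longestRun-attained (suc (suc N)) _ =
    extend (⊔-sel (longestRun f (suc N)) (runBefore f (suc (suc N)))) (longestRun-attained (suc N) z<s)
    where
    extend : longestRun f (suc (suc N)) ≡ longestRun f (suc N)
               ⊎ longestRun f (suc (suc N)) ≡ runBefore f (suc (suc N)) →
      ∃ (λ j → j < suc N × runBefore f (suc j) ≡ longestRun f (suc N)) →
      ∃ λ j → j < suc (suc N) × runBefore f (suc j) ≡ longestRun f (suc (suc N))
    extend (inj₂ isRun) _                       = suc N , ≤-refl , sym isRun
    extend (inj₁ isOld) (j , j<1+N , attains) = j , m<n⇒m<1+n j<1+N , trans attains (sym isOld)

  falseBlock-empty : ∀ j → FalseBlock f j 0
  falseBlock-empty j k k≤j j<k+0 = contradiction (subst (j <_) (+-identityʳ k) j<k+0) (≤⇒≯ k≤j)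

  runBefore-falseBlock : ∀ j → FalseBlock f j (runBefore f (suc j))
  runBefore-falseBlock j k k≤j j<k+run with f j in fj
  ... | true = contradiction (subst (_≤ j) (sym (+-identityʳ k)) k≤j) (<⇒≱ j<k+run)
  ... | false with m≤n⇒m<n∨m≡n k≤j
  ...   | inj₂ refl = fj
  runBefore-falseBlock (suc j) k k≤j j<k+run | false | inj₁ k<1+j =
    runBefore-falseBlock j k (s≤s⁻¹ k<1+j)
      (s≤s⁻¹ (subst (suc j <_) (+-suc k (runBefore f (suc j))) j<k+run))

  runBefore-start : f 0 ≡ true → ∀ j →
    runBefore f (suc j) ≤ j × f (j ∸ runBefore f (suc j)) ≡ true
  runBefore-start f0 j with f j in fj
  runBefore-start f0 j       | true  = z≤n , fj
  runBefore-start f0 zero    | false = contradiction (trans (sym f0) fj) λ ()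
  runBefore-start f0 (suc j) | false with runBefore-start f0 j
  ... | run≤j , start = s≤s run≤j , start

  segment : ℕ → ℕ → List Bool
  segment s zero    = []
  segment s (suc L) = f s ∷ segment (suc s) L

  segment-tabulate : ∀ L s (g : Fin L → Bool) →
    (∀ i → g i ≡ f (s + toℕ i)) → tabulate g ≡ segment s L
  segment-tabulate zero    s g g≗f = refl
  segment-tabulate (suc L) s g g≗f =
    cong₂ _∷_ (trans (g≗f fzero) (cong f (+-identityʳ s)))
      (segment-tabulate L (suc s) (λ i → g (fsuc i))
        (λ i → trans (g≗f (fsuc i)) (cong f (+-suc s (toℕ i)))))

  -- Invariant of the scan `runAux cur best` used to define mV₁: after reading
  -- positions below s, cur is the current run and best ⊔ cur the longest one.
  runAux-segment : ∀ L s cur best →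
    best ⊔ cur ≡ longestRun f s → cur ≡ runBefore f s →
    runAux cur best (segment s L) ≡ longestRun f (s + L)
  runAux-segment zero s cur best longest current =
    trans longest (cong (longestRun f) (sym (+-identityʳ s)))
  runAux-segment (suc L) s cur best longest current
    rewrite +-suc s L with f s in fs
  ... | true  = runAux-segment L (suc s) 0 (best ⊔ cur) longest′ refl′
    where
    refl′ : 0 ≡ runBefore f (suc s)
    refl′ rewrite fs = refl
    longest′ : (best ⊔ cur) ⊔ 0 ≡ longestRun f (suc s)
    longest′ rewrite fs = cong (_⊔ 0) longest
  ... | false = runAux-segment L (suc s) (suc cur) best longest′ current′
    where
    current′ : suc cur ≡ runBefore f (suc s)
    current′ rewrite fs = cong suc current
    longest′ : best ⊔ suc cur ≡ longestRun f (suc s)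
    longest′ rewrite fs | sym current = begin
      best ⊔ suc cur           ≡⟨ cong (best ⊔_) (sym (m≤n⇒m⊔n≡n (n≤1+n cur))) ⟩
      best ⊔ (cur ⊔ suc cur)   ≡⟨ sym (⊔-assoc best cur (suc cur)) ⟩
      (best ⊔ cur) ⊔ suc cur   ≡⟨ cong (_⊔ suc cur) longest ⟩
      longestRun f s ⊔ suc cur ∎
      where open ≡-Reasoning

-- The digraph of the companion matrix

module Companion {n} (r : Fin n → Bool) where

  A : Mat n
  A = companion r

  edge⁻¹ : ∀ {i k} → 0 < A i k → (suc (toℕ i) ≡ n × r k ≡ true) ⊎ toℕ k ≡ suc (toℕ i)
  edge⁻¹ {i} {k} = select-pos⁻¹ (suc (toℕ i) ≟ n) (r k) (toℕ k ≟ suc (toℕ i))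

  back-edge : ∀ {i k} → suc (toℕ i) ≡ n → r k ≡ true → 0 < A i k
  back-edge {i} {k} = select-then (suc (toℕ i) ≟ n) (r k) (toℕ k ≟ suc (toℕ i))

  forward-edge : ∀ {i k} → toℕ k ≡ suc (toℕ i) → 0 < A i k
  forward-edge {i} {k} fwd =
    select-else (suc (toℕ i) ≟ n) (r k) (toℕ k ≟ suc (toℕ i))
      (λ last → <⇒≢ (toℕ<n k) (trans fwd last)) fwd

  forward-walk : ∀ d {i k} → toℕ i + d ≡ toℕ k → Walk A d i k
  forward-walk zero {i} {k} i+0≡k =
    subst (Walk A 0 i) (toℕ-injective (trans (sym (+-identityʳ (toℕ i))) i+0≡k)) (walk-refl i)
  forward-walk (suc d) {i} {k} i+1+d≡k = walk-cons (forward-edge (toℕ-fromℕ< next<n))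
    (forward-walk d (trans (cong (_+ d) (toℕ-fromℕ< next<n)) 1+i+d≡k))
    where
    1+i+d≡k : suc (toℕ i + d) ≡ toℕ k
    1+i+d≡k = trans (sym (+-suc (toℕ i) d)) i+1+d≡k
    next<n : suc (toℕ i) < n
    next<n = ≤-<-trans (subst (suc (toℕ i) ≤_) 1+i+d≡k (s≤s (m≤m+n (toℕ i) d))) (toℕ<n k)

  loop-walk : ∀ {l} → suc (toℕ l) ≡ n → r l ≡ true → ∀ t → Walk A t l l
  loop-walk {l} last rl zero    = walk-refl l
  loop-walk     last rl (suc t) = walk-cons (back-edge last rl) (loop-walk last rl t)

  vertex0-unreachable : ∀ {m i j} → r j ≡ false → toℕ j ≡ 0 → Walk A m i j → m ≡ 0
  vertex0-unreachable {zero} rj j≡0 w = refl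
  vertex0-unreachable {suc m} rj j≡0 w with walk-uncons w
  ... | k , e , w′ with vertex0-unreachable rj j≡0 w′
  ...   | refl with walk-zero⁻¹ w′ | edge⁻¹ e
  ...     | refl | inj₁ (_ , rk) = contradiction (trans (sym rj) rk) λ ()
  ...     | refl | inj₂ fwd      = contradiction (trans (sym fwd) j≡0) λ ()

  row : ℕ → Bool
  row k with k <? n
  ... | yes k<n = r (fromℕ< k<n)
  ... | no _    = true

  row-toℕ : ∀ k → row (toℕ k) ≡ r k
  row-toℕ k with toℕ k <? n
  ... | yes k<n = cong r (fromℕ<-toℕ k k<n)
  ... | no k≮n  = contradiction (toℕ<n k) k≮n

  mV₁≡longestRun : mV₁ r ≡ longestRun row n
  mV₁≡longestRun =
    trans (cong (runAux 0 0) (segment-tabulate row n 0 r (λ i → sym (row-toℕ i))))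
          (runAux-segment row n 0 0 0 refl refl)

  -- `Reaches D j p`: a walk of potential p (start index + length) ending at j
  -- either only moved forward (p = j) or has p ≥ n + D.
  Reaches : ℕ → ℕ → ℕ → Set
  Reaches D j p = p ≡ j ⊎ n + D ≤ p

  -- After a back edge into k with r k = 1, a remaining walk of length m that
  -- reaches j forces n + D ≤ n + m: if it only moves forward, k lies before the
  -- zero block, so m ≥ D; otherwise its potential is already ≥ n + D.
  back-edge-potential : ∀ {D j k m} → FalseBlock row j D → r k ≡ true →
    Reaches D j (toℕ k + m) → n + D ≤ n + m
  back-edge-potential {D} {j} {k} {m} block rk (inj₁ forward) =
    +-monoʳ-≤ n (+-cancelˡ-≤ (toℕ k) D m (subst (toℕ k + D ≤_) (sym forward) (≮⇒≥ outsideBlock)))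
    where
    outsideBlock : ¬ j < toℕ k + D
    outsideBlock inBlock = contradiction
      (block (toℕ k) (subst (toℕ k ≤_) forward (m≤m+n _ _)) inBlock)
      (λ rowk≡false → contradiction (trans (sym rk) (trans (sym (row-toℕ k)) rowk≡false)) λ ())
  back-edge-potential {k = k} block rk (inj₂ long) = ≤-trans long (+-monoˡ-≤ _ (<⇒≤ (toℕ<n k)))

  -- Every walk ending at j
  -- satisfies `Reaches D j`: a forward edge keeps the potential, and a back edge
  -- lands before the zero block, so the remaining walk is long.
  walk-potential : ∀ {D j} → FalseBlock row (toℕ j) D →
    ∀ {m i} → Walk A m i j → Reaches D (toℕ j) (toℕ i + m)
  walk-potential block {zero} {i} w =
    inj₁ (trans (+-identityʳ (toℕ i)) (cong toℕ (walk-zero⁻¹ w)))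
  walk-potential {D} block {suc m} {i} w with walk-uncons w
  ... | k , e , w′ with edge⁻¹ e
  ...   | inj₂ fwd         = subst (Reaches _ _) forward-shift (walk-potential block w′)
    where
    forward-shift : toℕ k + m ≡ toℕ i + suc m
    forward-shift = trans (cong (_+ m) fwd) (sym (+-suc (toℕ i) m))
  ...   | inj₁ (last , rk) =
    inj₂ (subst (n + D ≤_) back-shift (back-edge-potential block rk (walk-potential block w′)))
    where
    back-shift : n + m ≡ toℕ i + suc m
    back-shift = trans (cong (_+ m) (sym last)) (sym (+-suc (toℕ i) m))

  -- Positive trace: some diagonal entry is an edge, necessarily a loop at the
  -- last vertex (a forward edge never returns to its source).
  trace-pos⇒loop : 0 < trace A → ∃ λ l → suc (toℕ l) ≡ n × r l ≡ true
  trace-pos⇒loop tr with sum-pos⁻¹ (λ i → A i i) tr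
  ... | l , e with edge⁻¹ e
  ...   | inj₁ loop  = l , loop
  ...   | inj₂ l≡1+l = contradiction (sym l≡1+l) 1+n≢n

  -- Primitivity forces r 0 = 1: a positive power has a nonempty walk into vertex 0.
  primitive⇒row0 : Primitive A → ∀ o → toℕ o ≡ 0 → r o ≡ true
  primitive⇒row0 (m , m≥1 , pos) o o≡0 with r o in ro
  ... | true  = refl
  ... | false = contradiction (vertex0-unreachable ro o≡0 (walk (pos o o))) (n>0⇒n≢0 m≥1)

  -- With c the zero block ending at j and s its start:
  -- forward to the last vertex l, loop there, jump back to s, forward to j.
  walk-upper : row 0 ≡ true → ∀ {l} → suc (toℕ l) ≡ n → r l ≡ true →
    ∀ i j → Walk A (n + longestRun row n) i j
  walk-upper row0 {l} last rl i j =
    subst (λ len → Walk A len i j) length-identity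
      (walk-++ to-last (walk-++ wait (walk-++ jump climb)))
    where
    M c : ℕ
    M = longestRun row n
    c = runBefore row (suc (toℕ j))

    c≤j : c ≤ toℕ j
    c≤j = proj₁ (runBefore-start row row0 (toℕ j))

    c≤M : c ≤ M
    c≤M = runBefore≤longestRun row (toℕ<n j)

    s<n : toℕ j ∸ c < n
    s<n = ≤-<-trans (m∸n≤m (toℕ j) c) (toℕ<n j)

    s : Fin n
    s = fromℕ< s<n

    rs : r s ≡ true
    rs = trans (sym (row-toℕ s))
               (trans (cong row (toℕ-fromℕ< s<n)) (proj₂ (runBefore-start row row0 (toℕ j))))

    i≤l : toℕ i ≤ toℕ l
    i≤l = s≤s⁻¹ (subst (toℕ i <_) (sym last) (toℕ<n i))

    to-last : Walk A (toℕ l ∸ toℕ i) i l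
    to-last = forward-walk _ (m+[n∸m]≡n i≤l)

    wait : Walk A ((M ∸ c) + toℕ i) l l
    wait = loop-walk last rl _

    jump : Walk A 1 l s
    jump = walk-cons (back-edge last rs) (walk-refl s)

    climb : Walk A c s j
    climb = forward-walk c (trans (cong (_+ c) (toℕ-fromℕ< s<n)) (m∸n+n≡m c≤j))

    regroup : ∀ a b x y → a + ((b + x) + (1 + y)) ≡ suc ((a + x) + (b + y))
    regroup = solve-∀

    length-identity : (toℕ l ∸ toℕ i) + (((M ∸ c) + toℕ i) + (1 + c)) ≡ n + M
    length-identity = begin
      (toℕ l ∸ toℕ i) + (((M ∸ c) + toℕ i) + (1 + c)) ≡⟨ regroup (toℕ l ∸ toℕ i) (M ∸ c) (toℕ i) c ⟩
      suc (((toℕ l ∸ toℕ i) + toℕ i) + ((M ∸ c) + c)) ≡⟨ cong suc (cong₂ _+_ (m∸n+n≡m i≤l) (m∸n+n≡m c≤M)) ⟩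
      suc (toℕ l + M)                                 ≡⟨ cong (_+ M) last ⟩
      n + M                                           ∎
      where open ≡-Reasoning

  origin-potential : ∀ {o} → toℕ o ≡ 0 → ∀ {D j} → FalseBlock row (toℕ j) D →
    ∀ {m} → Walk A m o j → Reaches D (toℕ j) m
  origin-potential o≡0 block w = subst (Reaches _ _) (cong (_+ _) o≡0) (walk-potential block w)

  -- A positive power A^m with m ≥ 1 has m ≥ n: the walk 0 → 0 cannot only move forward.
  positive-power⇒n≤m : ∀ o → toℕ o ≡ 0 → ∀ {m} → 1 ≤ m → Positive (A ^ᴹ m) → n ≤ m
  positive-power⇒n≤m o o≡0 m≥1 pos
    with origin-potential o≡0 (falseBlock-empty row (toℕ o)) (walk (pos o o))
  ... | inj₁ m≡0   = contradiction (trans m≡0 o≡0) (n>0⇒n≢0 m≥1)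
  ... | inj₂ n+0≤m = subst (_≤ _) (+-identityʳ n) n+0≤m

  -- Lower bound: a positive power A^m with m ≥ 1 has m ≥ n + M.  Take a walk from
  -- 0 to the end j of a longest zero block; it cannot only move forward, as j < n ≤ m.
  positive-power⇒long : ∀ o → toℕ o ≡ 0 → ∀ {m} → 1 ≤ m → Positive (A ^ᴹ m) →
    n + longestRun row n ≤ m
  positive-power⇒long o o≡0 m≥1 pos with longestRun-attained row n (subst (_< n) o≡0 (toℕ<n o))
  ... | j , j<n , attains
    with origin-potential o≡0
           (subst₂ (FalseBlock row) (sym (toℕ-fromℕ< j<n)) attains (runBefore-falseBlock row j))
           (walk (pos o (fromℕ< j<n)))
  ...   | inj₁ m≡j  = contradiction (positive-power⇒n≤m o o≡0 m≥1 pos)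
                        (<⇒≱ (subst (_< n) (sym (trans m≡j (toℕ-fromℕ< j<n))) j<n))
  ...   | inj₂ long = long

mainTheorem2 : (n : ℕ) → 2 ≤ n → (r : Fin n → Bool)
    → Primitive (companion r) → 0 < trace (companion r)
    → IsExponent (companion r) (n + mV₁ r)
mainTheorem2 (suc n) (s≤s _) r prim tr = z<s , upper , lower
  where
  open Companion r

  exponent≡ : suc n + mV₁ r ≡ suc n + longestRun row (suc n)
  exponent≡ = cong (suc n +_) mV₁≡longestRun

  row0 : row 0 ≡ true
  row0 = trans (row-toℕ fzero) (primitive⇒row0 prim fzero refl)

  upper : Positive (A ^ᴹ (suc n + mV₁ r))
  upper i j with trace-pos⇒loop tr
  ... | l , last , rl =
    positive (subst (λ e → Walk A e i j) (sym exponent≡) (walk-upper row0 last rl i j))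

  lower : ∀ m → 1 ≤ m → m < suc n + mV₁ r → ¬ Positive (A ^ᴹ m)
  lower m m≥1 m<e pos =
    <⇒≱ m<e (subst (_≤ m) (sym exponent≡) (positive-power⇒long fzero refl m≥1 pos))
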